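{- Let $G$ be a finite additive group and let $A,B$ be subsets of $G$, with complements $\overline{A} = G\setminus A$ and $\overline{B} = G \setminus B$. Then \[ r(A,B,B) + r(\overline{A},\overline{B},\overline{B}) = |A|\cdot|B| - |A|\cdot|\overline{B}| + |\overline{B}|^2. \]
   Context: For subsets $X,Y$ of $G$, $r(X,Y,Y)$ denotes the number of triples $(x,y,x+y)$ with $x \in X$, $y\in Y$ and $x+y \in Y$. -}

module Defs where

open import Level using (Level)
open import Algebra.Bundles using (AbelianGroup)
open import Data.Bool using (Bool; true; false; not; _∧_)
open import Data.Nat using (ℕ; zero; suc; _+_)
open import Data.Fin using (Fin)
open import Data.List using (List; length; filter; allFin; cartesianProduct)
open import Data.Product using (_×_; _,_; proj₁; proj₂)
open import Relation.Nullary using (Dec)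
open import Relation.Unary using () renaming (Decidable to DecidableU)
open import Relation.Binary.PropositionalEquality using (_≡_)

record FiniteAbelianGroup (c ℓ : Level) : Set (Level.suc (c Level.⊔ ℓ)) where
  field
    abGroup   : AbelianGroup c ℓ
  open AbelianGroup abGroup public
  field
    _≈?_      : (x y : Carrier) → Dec (x ≈ y)
    size      : ℕ
    enum      : Fin size → Carrier
    enum-inj  : ∀ i j → enum i ≈ enum j → i ≡ j
    enum-surj : ∀ x → Data.Product.Σ (Fin size) (λ i → enum i ≈ x)

module _ {c ℓ : Level} (G : FiniteAbelianGroup c ℓ) where
  open FiniteAbelianGroup G

  record Subset : Set (c Level.⊔ ℓ) where
    field
      mem      : Carrier → Bool
      mem-resp : ∀ {x y} → x ≈ y → mem x ≡ mem y
  open Subset public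

  complement : Subset → Subset
  complement A = record { mem = λ x → not (mem A x)
                        ; mem-resp = λ e → Relation.Binary.PropositionalEquality.cong not (mem-resp A e) }

  card : Subset → ℕ
  card A = length (filter (λ i → Data.Bool.T? (mem A (enum i))) (allFin size))

  r : Subset → Subset → Subset → ℕ
  r X Y Z = length (filter
    (λ p → Data.Bool.T? (mem X (enum (proj₁ p)) ∧ mem Y (enum (proj₂ p))
                          ∧ mem Z (enum (proj₁ p) ∙ enum (proj₂ p))))
    (cartesianProduct (allFin size) (allFin size)))

-- For fixed x and y, with a = [x ∈ A], b = [y ∈ B], c = [x + y ∈ B], one checks on the eight
-- truth assignments that
--   a b c + (1 - a)(1 - b)(1 - c) + a = a b + a c + (1 - b)(1 - c).
-- Summing over all pairs (x , y) and using that y ↦ x + y and x ↦ x + y are bijections of G gives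
--   r(A,B,B) + r(Ā,B̄,B̄) + |A| |G| = |A| |B| + |A| |B| + |B̄| |B̄|,
-- and |G| = |B| + |B̄| turns this into the claim.
module Submission where

open import Level using (Level)
open import Data.Bool using (Bool; true; false; not; _∧_; T?)
open import Data.Fin using (Fin; zero; suc)
open import Data.Fin.Permutation using (Permutation′; permutation)
open import Data.List using (List; []; _∷_; _++_; length; filter; map; tabulate; allFin; cartesianProduct)
import Data.List.Properties as List
open import Data.Nat.ListAction using () renaming (sum to sumˡ)
open import Data.Nat.ListAction.Properties using () renaming (sum-++ to sumˡ-++)
import Data.Nat as ℕ
import Data.Nat.Properties as ℕ
open import Data.Product using (_×_; _,_; proj₁; proj₂)
open import Function using (_∘_; id)
open import Relation.Binary.PropositionalEquality using (_≡_; refl; sym; trans; cong; cong₂; module ≡-Reasoning)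

open import Defs

-- ℕ's operators are opened only in this block: the statement uses those of Data.Integer.
module _ where
  open import Data.Nat using (ℕ; _+_; _*_)
  open import Algebra.Properties.Semiring.Sum ℕ.+-*-semiring
    using (sum; sum-cong-≗; ∑-distrib-+; ∑-comm; sum-permute; *-distribˡ-sum; *-distribʳ-sum)

  𝟙 : Bool → ℕ
  𝟙 true  = 1
  𝟙 false = 0

  𝟙-identity : ∀ a b c →
    𝟙 (a ∧ b ∧ c) + 𝟙 (not a ∧ not b ∧ not c) + 𝟙 a * (𝟙 b + 𝟙 (not b))
      ≡ 𝟙 a * 𝟙 b + 𝟙 a * 𝟙 c + 𝟙 (not b) * 𝟙 (not c)
  𝟙-identity true  true  true  = refl
  𝟙-identity true  true  false = refl
  𝟙-identity true  false true  = refl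
  𝟙-identity true  false false = refl
  𝟙-identity false true  true  = refl
  𝟙-identity false true  false = refl
  𝟙-identity false false true  = refl
  𝟙-identity false false false = refl

  length-filter≡sum-𝟙 : ∀ {a} {A : Set a} (p : A → Bool) (xs : List A) →
    length (filter (T? ∘ p) xs) ≡ sumˡ (map (𝟙 ∘ p) xs)
  length-filter≡sum-𝟙 p []       = refl
  length-filter≡sum-𝟙 p (x ∷ xs) with p x
  ... | true  = cong ℕ.suc (length-filter≡sum-𝟙 p xs)
  ... | false = length-filter≡sum-𝟙 p xs

  sumˡ-map-tabulate : ∀ {a} {A : Set a} {n} (h : A → ℕ) (g : Fin n → A) →
    sumˡ (map h (tabulate g)) ≡ sum (h ∘ g)
  sumˡ-map-tabulate {n = ℕ.zero}  h g = refl
  sumˡ-map-tabulate {n = ℕ.suc n} h g = cong (h (g zero) +_) (sumˡ-map-tabulate h (g ∘ suc))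

  sumˡ-map-cartesianProduct : ∀ {a b} {A : Set a} {B : Set b} (h : A × B → ℕ) xs ys →
    sumˡ (map h (cartesianProduct xs ys)) ≡ sumˡ (map (λ x → sumˡ (map (λ y → h (x , y)) ys)) xs)
  sumˡ-map-cartesianProduct h []       ys = refl
  sumˡ-map-cartesianProduct h (x ∷ xs) ys = begin
    sumˡ (map h (map (x ,_) ys ++ cartesianProduct xs ys))
      ≡⟨ cong sumˡ (List.map-++ h (map (x ,_) ys) _) ⟩
    sumˡ (map h (map (x ,_) ys) ++ map h (cartesianProduct xs ys))
      ≡⟨ sumˡ-++ (map h (map (x ,_) ys)) _ ⟩
    sumˡ (map h (map (x ,_) ys)) + sumˡ (map h (cartesianProduct xs ys))
      ≡⟨ cong₂ _+_ (cong sumˡ (sym (List.map-∘ ys))) (sumˡ-map-cartesianProduct h xs ys) ⟩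
    sumˡ (map (λ y → h (x , y)) ys) + sumˡ (map (λ x → sumˡ (map (λ y → h (x , y)) ys)) xs) ∎
    where open ≡-Reasoning

  ∑² : ∀ {m n} → (Fin m → Fin n → ℕ) → ℕ
  ∑² f = sum (λ i → sum (f i))

  ∑²-cong : ∀ {m n} {f g : Fin m → Fin n → ℕ} → (∀ i j → f i j ≡ g i j) → ∑² f ≡ ∑² g
  ∑²-cong f≡g = sum-cong-≗ (λ i → sum-cong-≗ (f≡g i))

  ∑²-distrib-+ : ∀ {m n} (f g : Fin m → Fin n → ℕ) → ∑² (λ i j → f i j + g i j) ≡ ∑² f + ∑² g
  ∑²-distrib-+ f g =
    trans (sum-cong-≗ (λ i → ∑-distrib-+ (f i) (g i))) (∑-distrib-+ (sum ∘ f) (sum ∘ g))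

  ∑²-distrib-+₃ : ∀ {m n} (f g h : Fin m → Fin n → ℕ) →
    ∑² (λ i j → f i j + g i j + h i j) ≡ ∑² f + ∑² g + ∑² h
  ∑²-distrib-+₃ f g h = trans (∑²-distrib-+ (λ i j → f i j + g i j) h) (cong (_+ ∑² h) (∑²-distrib-+ f g))

  ∑²-*-constant-rows : ∀ {m n} (f : Fin m → ℕ) (g : Fin m → Fin n → ℕ) {k} →
    (∀ i → sum (g i) ≡ k) → ∑² (λ i j → f i * g i j) ≡ sum f * k
  ∑²-*-constant-rows f g {k} rows = begin
    ∑² (λ i j → f i * g i j)  ≡⟨ sum-cong-≗ (λ i → sym (*-distribˡ-sum (f i) (g i))) ⟩
    sum (λ i → f i * sum (g i)) ≡⟨ sum-cong-≗ (λ i → cong (f i *_) (rows i)) ⟩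
    sum (λ i → f i * k)       ≡⟨ *-distribʳ-sum k f ⟨
    sum f * k                 ∎
    where open ≡-Reasoning

  module _ {c ℓ : Level} (G : FiniteAbelianGroup c ℓ) where
    open FiniteAbelianGroup G using (Carrier; _≈_; _∙_; _⁻¹; comm; group; size; enum; enum-inj; enum-surj)
    open import Algebra.Properties.Group group using (//-rightDividesˡ; //-rightDividesʳ)

    private
      index : Carrier → Fin size
      index x = proj₁ (enum-surj x)

      enum-index : ∀ x → enum (index x) ≈ x
      enum-index x = proj₂ (enum-surj x)

    translation : Carrier → Permutation′ size
    translation t = permutation (shift t) (shift (t ⁻¹))
      (λ j → enum-inj _ _ (enum-shift² (//-rightDividesˡ t (enum j))))
      (λ j → enum-inj _ _ (enum-shift² (//-rightDividesʳ t (enum j))))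
      where
      open FiniteAbelianGroup G using (∙-congʳ) renaming (trans to ≈-trans)
      shift : Carrier → Fin size → Fin size
      shift t j = index (enum j ∙ t)
      enum-shift² : ∀ {s u j x} → (enum j ∙ s) ∙ u ≈ x → enum (shift u (shift s j)) ≈ x
      enum-shift² {s} {u} {j} p =
        ≈-trans (enum-index _) (≈-trans (∙-congʳ (enum-index (enum j ∙ s))) p)

    sum-translate : (f : Carrier → ℕ) → (∀ {x y} → x ≈ y → f x ≡ f y) →
      ∀ t → sum (λ j → f (enum j ∙ t)) ≡ sum (f ∘ enum)
    sum-translate f f-resp t = sym (trans (sum-permute (f ∘ enum) (translation t))
      (sum-cong-≗ (λ j → f-resp (enum-index (enum j ∙ t)))))

    ∣_∣ : Subset G → ℕ
    ∣ X ∣ = sum (λ i → 𝟙 (mem X (enum i)))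

    card≡∣∣ : ∀ X → card G X ≡ ∣ X ∣
    card≡∣∣ X = trans (length-filter≡sum-𝟙 (mem X ∘ enum) (allFin size))
      (sumˡ-map-tabulate (𝟙 ∘ mem X ∘ enum) id)

    r≡∑² : ∀ X Y Z → r G X Y Z ≡
      ∑² (λ i j → 𝟙 (mem X (enum i) ∧ mem Y (enum j) ∧ mem Z (enum i ∙ enum j)))
    r≡∑² X Y Z = begin
      r G X Y Z
        ≡⟨ length-filter≡sum-𝟙 triple (cartesianProduct (allFin size) (allFin size)) ⟩
      sumˡ (map (𝟙 ∘ triple) (cartesianProduct (allFin size) (allFin size)))
        ≡⟨ sumˡ-map-cartesianProduct (𝟙 ∘ triple) (allFin size) (allFin size) ⟩
      sumˡ (map (λ i → sumˡ (map (λ j → 𝟙 (triple (i , j))) (allFin size))) (allFin size))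
        ≡⟨ cong sumˡ (List.map-cong (λ i → sumˡ-map-tabulate (λ j → 𝟙 (triple (i , j))) id) (allFin size)) ⟩
      sumˡ (map (λ i → sum (λ j → 𝟙 (triple (i , j)))) (allFin size))
        ≡⟨ sumˡ-map-tabulate (λ i → sum (λ j → 𝟙 (triple (i , j)))) id ⟩
      ∑² (λ i j → 𝟙 (triple (i , j))) ∎
      where
      open ≡-Reasoning
      triple : Fin size × Fin size → Bool
      triple (i , j) = mem X (enum i) ∧ mem Y (enum j) ∧ mem Z (enum i ∙ enum j)

    r-complement-identity : ∀ A B →
      r G A B B + r G (complement G A) (complement G B) (complement G B)
        + card G A * (card G B + card G (complement G B))
      ≡ card G A * card G B + card G A * card G B
        + card G (complement G B) * card G (complement G B)
    r-complement-identity A B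
      rewrite r≡∑² A B B | r≡∑² (complement G A) (complement G B) (complement G B)
            | card≡∣∣ A | card≡∣∣ B | card≡∣∣ (complement G B) = begin
      ∑² t₁ + ∑² t₂ + ∣ A ∣ * (∣ B ∣ + ∣ B̄ ∣)  ≡⟨ cong (∑² t₁ + ∑² t₂ +_) ∑²-t₃ ⟨
      ∑² t₁ + ∑² t₂ + ∑² t₃                   ≡⟨ ∑²-distrib-+₃ t₁ t₂ t₃ ⟨
      ∑² (λ i j → t₁ i j + t₂ i j + t₃ i j)    ≡⟨ ∑²-cong (λ i j → 𝟙-identity (a i) (b j) (b+ i j)) ⟩
      ∑² (λ i j → u₁ i j + u₂ i j + u₃ i j)    ≡⟨ ∑²-distrib-+₃ u₁ u₂ u₃ ⟩
      ∑² u₁ + ∑² u₂ + ∑² u₃                   ≡⟨ cong₂ _+_ (cong₂ _+_ ∑²-u₁ ∑²-u₂) ∑²-u₃ ⟩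
      ∣ A ∣ * ∣ B ∣ + ∣ A ∣ * ∣ B ∣ + ∣ B̄ ∣ * ∣ B̄ ∣ ∎
      where
      open ≡-Reasoning
      B̄ = complement G B
      a b : Fin size → Bool
      a i = mem A (enum i)
      b j = mem B (enum j)
      b+ : Fin size → Fin size → Bool
      b+ i j = mem B (enum i ∙ enum j)

      t₁ t₂ t₃ u₁ u₂ u₃ : Fin size → Fin size → ℕ
      t₁ i j = 𝟙 (a i ∧ b j ∧ b+ i j)
      t₂ i j = 𝟙 (not (a i) ∧ not (b j) ∧ not (b+ i j))
      t₃ i j = 𝟙 (a i) * (𝟙 (b j) + 𝟙 (not (b j)))
      u₁ i j = 𝟙 (a i) * 𝟙 (b j)
      u₂ i j = 𝟙 (a i) * 𝟙 (b+ i j)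
      u₃ i j = 𝟙 (not (b j)) * 𝟙 (not (b+ i j))

      ∑²-t₃ : ∑² t₃ ≡ ∣ A ∣ * (∣ B ∣ + ∣ B̄ ∣)
      ∑²-t₃ = ∑²-*-constant-rows (𝟙 ∘ a) (λ _ j → 𝟙 (b j) + 𝟙 (not (b j)))
        (λ _ → ∑-distrib-+ (𝟙 ∘ b) (𝟙 ∘ not ∘ b))

      ∑²-u₁ : ∑² u₁ ≡ ∣ A ∣ * ∣ B ∣
      ∑²-u₁ = ∑²-*-constant-rows (𝟙 ∘ a) (λ _ → 𝟙 ∘ b) (λ _ → refl)

      ∑²-u₂ : ∑² u₂ ≡ ∣ A ∣ * ∣ B ∣
      ∑²-u₂ = ∑²-*-constant-rows (𝟙 ∘ a) (λ i j → 𝟙 (b+ i j)) λ i →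
        trans (sum-cong-≗ (λ j → cong 𝟙 (mem-resp B (comm (enum i) (enum j)))))
              (sum-translate (𝟙 ∘ mem B) (cong 𝟙 ∘ mem-resp B) (enum i))

      ∑²-u₃ : ∑² u₃ ≡ ∣ B̄ ∣ * ∣ B̄ ∣
      ∑²-u₃ = trans (∑-comm u₃) (∑²-*-constant-rows (𝟙 ∘ not ∘ b) (λ j i → 𝟙 (not (b+ i j)))
        (sum-translate (𝟙 ∘ mem B̄) (cong 𝟙 ∘ mem-resp B̄) ∘ enum))

open import Data.Integer using (+_; _+_; _-_; _*_)
open import Data.Integer.Properties using (pos-+; pos-*)
open import Data.Integer.Tactic.RingSolver using (solve-∀)

ℕ-identity⇒ℤ-identity : ∀ s a b c →
  s ℕ.+ a ℕ.* (b ℕ.+ c) ≡ a ℕ.* b ℕ.+ a ℕ.* b ℕ.+ c ℕ.* c →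
  + s ≡ (+ a * + b) - (+ a * + c) + (+ c * + c)
ℕ-identity⇒ℤ-identity s a b c eq = begin
  + s
    ≡⟨ add-sub (+ s) (+ a * (+ b + + c)) ⟩
  + s + + a * (+ b + + c) - + a * (+ b + + c)
    ≡⟨ cong (_- + a * (+ b + + c)) eqℤ ⟩
  + a * + b + + a * + b + + c * + c - + a * (+ b + + c)
    ≡⟨ rearrange (+ a) (+ b) (+ c) ⟩
  (+ a * + b) - (+ a * + c) + (+ c * + c) ∎
  where
  open ≡-Reasoning
  add-sub : ∀ x z → x ≡ x + z - z
  add-sub = solve-∀
  rearrange : ∀ x y z → x * y + x * y + z * z - x * (y + z) ≡ x * y - x * z + z * z
  rearrange = solve-∀
  eqℤ : + s + + a * (+ b + + c) ≡ + a * + b + + a * + b + + c * + c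
  eqℤ = begin
    + s + + a * (+ b + + c)     ≡⟨ cong (λ k → + s + + a * k) (pos-+ b c) ⟨
    + s + + a * + (b ℕ.+ c)     ≡⟨ cong (λ k → + s + k) (pos-* a (b ℕ.+ c)) ⟨
    + s + + (a ℕ.* (b ℕ.+ c))   ≡⟨ pos-+ s _ ⟨
    + (s ℕ.+ a ℕ.* (b ℕ.+ c))   ≡⟨ cong +_ eq ⟩
    + (a ℕ.* b ℕ.+ a ℕ.* b ℕ.+ c ℕ.* c) ≡⟨ pos-+ _ (c ℕ.* c) ⟩
    + (a ℕ.* b ℕ.+ a ℕ.* b) + + (c ℕ.* c)
      ≡⟨ cong₂ _+_ (trans (pos-+ (a ℕ.* b) _) (cong₂ _+_ (pos-* a b) (pos-* a b))) (pos-* c c) ⟩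
    + a * + b + + a * + b + + c * + c ∎

theorem5 : ∀ {c ℓ : Level} (G : FiniteAbelianGroup c ℓ) (A B : Subset G) →
    + r G A B B + + r G (complement G A) (complement G B) (complement G B)
      ≡
    (+ card G A * + card G B) - (+ card G A * + card G (complement G B))
      + (+ card G (complement G B) * + card G (complement G B))
theorem5 G A B = trans (sym (pos-+ (r G A B B) _))
  (ℕ-identity⇒ℤ-identity _ (card G A) (card G B) (card G (complement G B))
    (r-complement-identity G A B))
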